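{- Let $G=(V,E)$ be an undirected graph with positive edge weights and terminal set $T\subseteq V$, and let $s\in V$ be such that for every vertex $t\neq s$ the minimum $s$-$t$ cut is unique. For any cut threshold $X=ct(s,\phi)$ and any extreme set $Y$, the sets $X\cap T$ and $Y\cap T$ do not cross.
   Context: For $X\subseteq V$, $d(X)$ is the total weight of edges with exactly one endpoint in $X$; $\lambda(s,t)$ is the minimum $s$-$t$ cut value. The cut threshold is $ct(s,\phi)=\{t\in V\setminus\{s\}:\lambda(s,t)\ge\phi\}\cup\{s\}$. A Steiner cut is a set $X\subseteq V$ with $X\cap T\neq\emptyset$ and $T\not\subseteq X$; it is extreme if every Steiner cut $Y\subsetneq X$ satisfies $d(Y)>d(X)$. Two sets $A,B$ cross if $A\cap B$, $A\setminus B$, $B\setminus A$ are all nonempty.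
   Formalization: The edge weights of G and the threshold φ of the cut thresholds ct(s,φ) take only rational values. -}

module Defs where

open import Data.Nat using (ℕ)
open import Data.Bool using (Bool; true; false; if_then_else_)
open import Data.Fin using (Fin)
open import Data.Fin.Subset using (Subset; _∈_; _∉_; _⊂_; _∩_; _─_; Nonempty; _⊆_)
open import Data.List using (List; map; foldr; allFin)
open import Data.Vec using (lookup)
open import Data.Rational using (ℚ; 0ℚ; _+_; _≤_; _<_)
open import Data.Product using (_×_; Σ)
open import Data.Sum using (_⊎_)
open import Relation.Binary.PropositionalEquality using (_≡_; _≢_)
open import Relation.Nullary using (¬_)

-- A weighted undirected graph on the vertex set Fin n.  The weight
-- w i j is the (total) weight of the edge {i,j}; w i j ≡ 0ℚ means there
-- is no edge, and every edge has positive weight.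
record WGraph (n : ℕ) : Set where
  field
    w      : Fin n → Fin n → ℚ
    w-sym  : ∀ i j → w i j ≡ w j i
    w-nonneg : ∀ i j → 0ℚ ≤ w i j

open WGraph public

sumℚ : List ℚ → ℚ
sumℚ = foldr _+_ 0ℚ

crossW : ∀ {n} → WGraph n → Subset n → Fin n → Fin n → ℚ
crossW G X i j with lookup X i | lookup X j
... | true  | false = w G i j
... | _     | _     = 0ℚ

d : ∀ {n} → WGraph n → Subset n → ℚ
d {n} G X = sumℚ (map (λ i → sumℚ (map (λ j → crossW G X i j) (allFin n))) (allFin n))

SepCut : ∀ {n} → Fin n → Fin n → Subset n → Set
SepCut s t X = s ∈ X × t ∉ X

IsMinCut : ∀ {n} → WGraph n → Fin n → Fin n → Subset n → Set
IsMinCut G s t X = SepCut s t X × (∀ Y → SepCut s t Y → d G X ≤ d G Y)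

UniqueMinCuts : ∀ {n} → WGraph n → Fin n → Set
UniqueMinCuts G s = ∀ t → t ≢ s → ∀ X Y → IsMinCut G s t X → IsMinCut G s t Y → X ≡ Y

λ≥ : ∀ {n} → WGraph n → Fin n → Fin n → ℚ → Set
λ≥ G s t φ = ∀ Y → SepCut s t Y → φ ≤ d G Y

IsCutThreshold : ∀ {n} → WGraph n → Fin n → ℚ → Subset n → Set
IsCutThreshold G s φ X =
  ∀ v → (v ∈ X → v ≡ s ⊎ (v ≢ s × λ≥ G s v φ))
      × (v ≡ s ⊎ (v ≢ s × λ≥ G s v φ) → v ∈ X)

SteinerCut : ∀ {n} → Subset n → Subset n → Set
SteinerCut T X = Nonempty (X ∩ T) × ¬ (T ⊆ X)

Extreme : ∀ {n} → WGraph n → Subset n → Subset n → Set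
Extreme G T X = SteinerCut T X × (∀ Y → Y ⊂ X → SteinerCut T Y → d G X < d G Y)

Cross : ∀ {n} → Subset n → Subset n → Set
Cross A B = Nonempty (A ∩ B) × Nonempty (A ─ B) × Nonempty (B ─ A)

{-# OPTIONS --safe #-}
module Submission where

-- Suppose a ∈ X ∩ Y ∩ T, b ∈ (X ─ Y) ∩ T and c ∈ (Y ─ X) ∩ T; we show
-- λ(s,c) ≥ φ, contradicting c ∉ X.  Let Z be an s-c cut with d(Z) < φ.
-- Every vertex of X is φ-connected to s, so X ⊆ Z.  Then Y ─ Z is a
-- Steiner cut (it contains c but not a) properly inside the extreme set Y,
-- so d(Y) < d(Y ─ Z); and Z ─ Y separates s from a (if s ∉ Y) or from b
-- (if s ∈ Y), so d(Z ─ Y) ≥ φ > d(Z).  This contradicts posimodularity,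
-- d(Y ─ Z) + d(Z ─ Y) ≤ d(Y) + d(Z).

open import Defs
import Algebra.Properties.CommutativeMonoid.Sum as Sum
open import Data.Bool using (Bool; true; false; _∧_; _∨_; not)
open import Data.Fin using (Fin; zero; suc)
open import Data.Fin.Subset using (Subset; _∩_; _∪_; ∁; _∈_; _∉_; _⊆_; _─_; outside)
open import Data.Fin.Subset.Properties
  using (_∈?_; x∈p∩q⁺; x∈p∩q⁻; x∈p∪q⁺; x∈p∪q⁻; x∈∁p⇒x∉p; x∉p⇒x∈∁p; x∈p⇒x∉∁p; p─q⊆p)
open import Data.List using (map; tabulate; allFin)
open import Data.Nat using (ℕ)
open import Data.Product using (_×_; _,_; proj₁; proj₂)
open import Data.Rational using (ℚ; 0ℚ; _+_; _≤_; _<_)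
open import Data.Rational.Properties
  using (+-0-commutativeMonoid; +-comm; +-mono-≤; +-monoʳ-≤; +-monoˡ-<; +-monoʳ-<;
         ≤-refl; ≤-reflexive; <-irrefl; <-≤-trans; ≮⇒≥; module ≤-Reasoning)
open import Data.Sum using (inj₁; inj₂; [_,_])
open import Data.Vec using (_∷_; lookup; here; there)
open import Data.Vec.Properties using (lookup-zipWith; lookup-map)
open import Function using (id; _∘_)
open import Relation.Nullary using (¬_; yes; no; contradiction)
open import Relation.Binary.PropositionalEquality
  using (_≡_; _≢_; refl; sym; trans; cong; cong₂; subst; module ≡-Reasoning)

open Sum +-0-commutativeMonoid using (sum; sum-syntax; ∑-distrib-+; ∑-comm; sum-cong-≗)

private
  variable
    n : ℕ

sumℚ-map-tabulate : ∀ {A : Set} {n} (f : A → ℚ) (g : Fin n → A) →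
                    sumℚ (map f (tabulate g)) ≡ ∑[ i < n ] f (g i)
sumℚ-map-tabulate {n = ℕ.zero}  f g = refl
sumℚ-map-tabulate {n = ℕ.suc n} f g = cong (f (g zero) +_) (sumℚ-map-tabulate f (g ∘ suc))

∑-mono-≤ : {f g : Fin n → ℚ} → (∀ i → f i ≤ g i) → sum f ≤ sum g
∑-mono-≤ {n = ℕ.zero}  f≤g = ≤-refl
∑-mono-≤ {n = ℕ.suc n} f≤g = +-mono-≤ (f≤g zero) (∑-mono-≤ (f≤g ∘ suc))

d-as-∑ : (G : WGraph n) (X : Subset n) → d G X ≡ ∑[ i < n ] ∑[ j < n ] crossW G X i j
d-as-∑ {n} G X = trans (sumℚ-map-tabulate (λ i → sumℚ (map (crossW G X i) (allFin n))) id)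
                       (sum-cong-≗ (λ i → sumℚ-map-tabulate (crossW G X i) id))

d+d-as-∑ : (G : WGraph n) (A B : Subset n) →
           d G A + d G B ≡ ∑[ i < n ] ∑[ j < n ] (crossW G A i j + crossW G B i j)
d+d-as-∑ G A B = begin
  d G A + d G B
    ≡⟨ cong₂ _+_ (d-as-∑ G A) (d-as-∑ G B) ⟩
  sum (λ i → sum (crossW G A i)) + sum (λ i → sum (crossW G B i))
    ≡⟨ sym (∑-distrib-+ (λ i → sum (crossW G A i)) (λ i → sum (crossW G B i))) ⟩
  sum (λ i → sum (crossW G A i) + sum (crossW G B i))
    ≡⟨ sum-cong-≗ (λ i → sym (∑-distrib-+ (crossW G A i) (crossW G B i))) ⟩
  sum (λ i → sum (λ j → crossW G A i j + crossW G B i j))  ∎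
  where open ≡-Reasoning

crossᵇ : Bool → Bool → ℚ → ℚ
crossᵇ true false q = q
crossᵇ _    _     q = 0ℚ

crossW-lookup : (G : WGraph n) (X : Subset n) (i j : Fin n) →
                crossW G X i j ≡ crossᵇ (lookup X i) (lookup X j) (w G i j)
crossW-lookup G X i j with lookup X i | lookup X j
... | true  | true  = refl
... | true  | false = refl
... | false | _     = refl

crossᵇ-submodular : ∀ x y x′ y′ q → 0ℚ ≤ q →
  crossᵇ (x ∧ y) (x′ ∧ y′) q + crossᵇ (x ∨ y) (x′ ∨ y′) q ≤ crossᵇ x x′ q + crossᵇ y y′ q
crossᵇ-submodular true  true  true  true  q 0≤q = ≤-refl
crossᵇ-submodular true  true  true  false q 0≤q = ≤-reflexive (+-comm q 0ℚ)
crossᵇ-submodular true  true  false true  q 0≤q = ≤-refl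
crossᵇ-submodular true  true  false false q 0≤q = ≤-refl
crossᵇ-submodular true  false true  true  q 0≤q = ≤-refl
crossᵇ-submodular true  false true  false q 0≤q = ≤-refl
crossᵇ-submodular true  false false true  q 0≤q = +-mono-≤ 0≤q ≤-refl
crossᵇ-submodular true  false false false q 0≤q = ≤-reflexive (+-comm 0ℚ q)
crossᵇ-submodular false true  true  true  q 0≤q = ≤-refl
crossᵇ-submodular false true  true  false q 0≤q = +-mono-≤ ≤-refl 0≤q
crossᵇ-submodular false true  false true  q 0≤q = ≤-refl
crossᵇ-submodular false true  false false q 0≤q = ≤-refl
crossᵇ-submodular false false true  true  q 0≤q = ≤-refl
crossᵇ-submodular false false true  false q 0≤q = ≤-refl
crossᵇ-submodular false false false true  q 0≤q = ≤-refl
crossᵇ-submodular false false false false q 0≤q = ≤-refl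

crossᵇ-not : ∀ x y q → crossᵇ (not x) (not y) q ≡ crossᵇ y x q
crossᵇ-not true  true  q = refl
crossᵇ-not true  false q = refl
crossᵇ-not false true  q = refl
crossᵇ-not false false q = refl

crossW-submodular : (G : WGraph n) (A B : Subset n) (i j : Fin n) →
  crossW G (A ∩ B) i j + crossW G (A ∪ B) i j ≤ crossW G A i j + crossW G B i j
crossW-submodular G A B i j
  rewrite crossW-lookup G (A ∩ B) i j | crossW-lookup G (A ∪ B) i j
        | crossW-lookup G A i j | crossW-lookup G B i j
        | lookup-zipWith _∧_ i A B | lookup-zipWith _∧_ j A B
        | lookup-zipWith _∨_ i A B | lookup-zipWith _∨_ j A B
  = crossᵇ-submodular (lookup A i) (lookup B i) (lookup A j) (lookup B j) (w G i j) (w-nonneg G i j)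

crossW-∁ : (G : WGraph n) (Z : Subset n) (i j : Fin n) → crossW G (∁ Z) i j ≡ crossW G Z j i
crossW-∁ G Z i j
  rewrite crossW-lookup G (∁ Z) i j | crossW-lookup G Z j i
        | lookup-map i not Z | lookup-map j not Z | w-sym G i j
  = crossᵇ-not (lookup Z i) (lookup Z j) (w G j i)

d-submodular : (G : WGraph n) (A B : Subset n) → d G (A ∩ B) + d G (A ∪ B) ≤ d G A + d G B
d-submodular G A B = begin
  d G (A ∩ B) + d G (A ∪ B)  ≡⟨ d+d-as-∑ G (A ∩ B) (A ∪ B) ⟩
  _                          ≤⟨ ∑-mono-≤ (λ i → ∑-mono-≤ (crossW-submodular G A B i)) ⟩
  _                          ≡⟨ sym (d+d-as-∑ G A B) ⟩
  d G A + d G B              ∎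
  where open ≤-Reasoning

d-∁ : (G : WGraph n) (Z : Subset n) → d G (∁ Z) ≡ d G Z
d-∁ G Z = begin
  d G (∁ Z)                                ≡⟨ d-as-∑ G (∁ Z) ⟩
  ∑[ i < _ ] ∑[ j < _ ] crossW G (∁ Z) i j  ≡⟨ sum-cong-≗ (λ i → sum-cong-≗ (crossW-∁ G Z i)) ⟩
  ∑[ i < _ ] ∑[ j < _ ] crossW G Z j i      ≡⟨ ∑-comm (λ i j → crossW G Z j i) ⟩
  ∑[ j < _ ] ∑[ i < _ ] crossW G Z j i      ≡⟨ sym (d-as-∑ G Z) ⟩
  d G Z                                    ∎
  where open ≡-Reasoning

-- Since d (A ∪ ∁ B) = d (B ─ A), this is posimodularity of d.
d-posimodular : (G : WGraph n) (A B : Subset n) → d G (A ∩ ∁ B) + d G (A ∪ ∁ B) ≤ d G A + d G B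
d-posimodular G A B = subst (λ x → d G (A ∩ ∁ B) + d G (A ∪ ∁ B) ≤ d G A + x) (d-∁ G B)
                            (d-submodular G A (∁ B))

x∈p─q⇒x∉q : ∀ (p q : Subset n) {x} → x ∈ p ─ q → x ∉ q
x∈p─q⇒x∉q (_ ∷ p) (outside ∷ q) here ()
x∈p─q⇒x∉q (_ ∷ p) (_ ∷ q) (there x∈p─q) (there x∈q) = x∈p─q⇒x∉q p q x∈p─q x∈q

x∈[p∩r]∩[q∩r]⁻ : ∀ (p q r : Subset n) {x} → x ∈ (p ∩ r) ∩ (q ∩ r) → x ∈ p × x ∈ q × x ∈ r
x∈[p∩r]∩[q∩r]⁻ p q r x∈ =
  let x∈p∩r , x∈q∩r = x∈p∩q⁻ (p ∩ r) (q ∩ r) x∈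
  in proj₁ (x∈p∩q⁻ p r x∈p∩r) , x∈p∩q⁻ q r x∈q∩r

x∈[p∩r]─[q∩r]⁻ : ∀ (p q r : Subset n) {x} → x ∈ (p ∩ r) ─ (q ∩ r) → x ∈ p × x ∈ r × x ∉ q
x∈[p∩r]─[q∩r]⁻ p q r x∈ =
  let x∈p , x∈r = x∈p∩q⁻ p r (p─q⊆p (p ∩ r) (q ∩ r) x∈)
  in x∈p , x∈r , λ x∈q → x∈p─q⇒x∉q (p ∩ r) (q ∩ r) x∈ (x∈p∩q⁺ (x∈q , x∈r))

module _ {G : WGraph n} {s : Fin n} {φ : ℚ} where

  λ≥-reversed : ∀ {t Z} → λ≥ G s t φ → t ∈ Z → s ∉ Z → φ ≤ d G Z
  λ≥-reversed {Z = Z} λst≥φ t∈Z s∉Z =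
    subst (φ ≤_) (d-∁ G Z) (λst≥φ (∁ Z) (x∉p⇒x∈∁p s∉Z , x∈p⇒x∉∁p t∈Z))

  module _ {X : Subset n} (X-ct : IsCutThreshold G s φ X) where

    s∈threshold : s ∈ X
    s∈threshold = proj₂ (X-ct s) (inj₁ refl)

    threshold-λ≥ : ∀ {u} → u ∈ X → u ≢ s → λ≥ G s u φ
    threshold-λ≥ {u} u∈X u≢s with proj₁ (X-ct u) u∈X
    ... | inj₁ u≡s          = contradiction u≡s u≢s
    ... | inj₂ (_ , λsu≥φ) = λsu≥φ

    λ≥⇒∈threshold : ∀ {u} → u ≢ s → λ≥ G s u φ → u ∈ X
    λ≥⇒∈threshold {u} u≢s λsu≥φ = proj₂ (X-ct u) (inj₂ (u≢s , λsu≥φ))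

    threshold⊆light-cut : ∀ {Z} → s ∈ Z → d G Z < φ → X ⊆ Z
    threshold⊆light-cut {Z} s∈Z dZ<φ {u} u∈X with u ∈? Z
    ... | yes u∈Z = u∈Z
    ... | no  u∉Z = contradiction (<-≤-trans dZ<φ (threshold-λ≥ u∈X u≢s Z (s∈Z , u∉Z))) (<-irrefl refl)
      where
      u≢s : u ≢ s
      u≢s refl = u∉Z s∈Z

extreme-⊂ : ∀ {G : WGraph n} {T Y Z a c} → Extreme G T Y →
            a ∈ Y → a ∈ T → a ∈ Z → c ∈ Y → c ∈ T → c ∉ Z → d G Y < d G (Y ∩ ∁ Z)
extreme-⊂ {Y = Y} {Z} (_ , Y-min) a∈Y a∈T a∈Z c∈Y c∈T c∉Z =
  Y-min (Y ∩ ∁ Z) (proj₁ ∘ x∈p∩q⁻ Y (∁ Z) , _ , a∈Y , a∉Y∩∁Z)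
        ((_ , x∈p∩q⁺ (x∈p∩q⁺ (c∈Y , x∉p⇒x∈∁p c∉Z) , c∈T)) , λ T⊆Y∩∁Z → a∉Y∩∁Z (T⊆Y∩∁Z a∈T))
  where
  a∉Y∩∁Z : _ ∉ Y ∩ ∁ Z
  a∉Y∩∁Z a∈Y∩∁Z = x∈∁p⇒x∉p (proj₂ (x∈p∩q⁻ Y (∁ Z) a∈Y∩∁Z)) a∈Z

threshold-extreme-λ≥ : ∀ {G : WGraph n} {T s φ X Y a b c} →
  IsCutThreshold G s φ X → Extreme G T Y →
  a ∈ X → a ∈ Y → a ∈ T → b ∈ X → b ∉ Y → c ∈ Y → c ∈ T → λ≥ G s c φ
threshold-extreme-λ≥ {G = G} {s = s} {φ} {Y = Y} X-ct Y-ext a∈X a∈Y a∈T b∈X b∉Y c∈Y c∈T Z (s∈Z , c∉Z) =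
  ≮⇒≥ light-cut-impossible
  where
  open ≤-Reasoning
  U = Y ∪ ∁ Z

  light-cut-impossible : ¬ d G Z < φ
  light-cut-impossible dZ<φ = <-irrefl refl (begin-strict
    d G Y + φ                  ≤⟨ +-monoʳ-≤ (d G Y) φ≤dU ⟩
    d G Y + d G U              <⟨ +-monoˡ-< (d G U) dY<dY∩∁Z ⟩
    d G (Y ∩ ∁ Z) + d G U      ≤⟨ d-posimodular G Y Z ⟩
    d G Y + d G Z              <⟨ +-monoʳ-< (d G Y) dZ<φ ⟩
    d G Y + φ                  ∎)
    where
    X⊆Z = threshold⊆light-cut X-ct s∈Z dZ<φ
    dY<dY∩∁Z = extreme-⊂ Y-ext a∈Y a∈T (X⊆Z a∈X) c∈Y c∈T c∉Z

    φ≤dU : φ ≤ d G U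
    φ≤dU with s ∈? Y
    ... | yes s∈Y = threshold-λ≥ X-ct b∈X (λ { refl → b∉Y s∈Y }) U
                      (x∈p∪q⁺ (inj₁ s∈Y) , [ b∉Y , x∈p⇒x∉∁p (X⊆Z b∈X) ] ∘ x∈p∪q⁻ Y (∁ Z))
    ... | no  s∉Y = λ≥-reversed (threshold-λ≥ X-ct a∈X λ { refl → s∉Y a∈Y })
                      (x∈p∪q⁺ (inj₁ a∈Y)) ([ s∉Y , x∈p⇒x∉∁p s∈Z ] ∘ x∈p∪q⁻ Y (∁ Z))

mainTheorem10 : ∀ {n} (G : WGraph n) (T : Subset n) (s : Fin n) →
    UniqueMinCuts G s →
    ∀ (φ : ℚ) (X Y : Subset n) →
    IsCutThreshold G s φ X → Extreme G T Y →
    ¬ Cross (X ∩ T) (Y ∩ T)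
mainTheorem10 G T s _ φ X Y X-ct Y-ext ((a , a∈) , (b , b∈) , (c , c∈))
  with x∈[p∩r]∩[q∩r]⁻ X Y T a∈ | x∈[p∩r]─[q∩r]⁻ X Y T b∈ | x∈[p∩r]─[q∩r]⁻ Y X T c∈
... | a∈X , a∈Y , a∈T | b∈X , _ , b∉Y | c∈Y , c∈T , c∉X =
  c∉X (λ≥⇒∈threshold X-ct c≢s (threshold-extreme-λ≥ X-ct Y-ext a∈X a∈Y a∈T b∈X b∉Y c∈Y c∈T))
  where
  c≢s : c ≢ s
  c≢s refl = c∉X (s∈threshold X-ct)
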